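{- For every $n\ge2$ and every $\pi,\tau\in S_n$ we have $L(\tau\pi)=L(\pi)L(\tau)$, where $\tau\pi$ denotes the composition $(\tau\pi)(i)=\tau(\pi(i))$.
   Context: For $\pi\in S_n$, $L(\pi)$ is the $(n-1)\times(n-1)$ matrix with entries $(L(\pi))_{ij}=\operatorname{sgn}(\pi(i+1)-\pi(i))$ if $\min(\pi(i),\pi(i+1))\le j<\max(\pi(i),\pi(i+1))$, and $(L(\pi))_{ij}=0$ otherwise ($1\le i,j\le n-1$). -}

module Defs where

open import Data.Nat as ℕ using (ℕ; suc)
open import Data.Fin using (Fin; toℕ; inject₁) renaming (suc to fsuc; zero to fzero)
open import Data.Fin.Permutation using (Permutation′; _⟨$⟩ʳ_)
open import Data.Integer using (ℤ; +_; -[1+_]; _*_; _+_)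
open import Data.Bool using (Bool; true; false; _∧_; if_then_else_)
open import Relation.Nullary.Decidable using (⌊_⌋)

sgnDiff : ℕ → ℕ → ℤ
sgnDiff a b with ⌊ a ℕ.<? b ⌋ | ⌊ b ℕ.<? a ⌋
... | true  | _     = + 1
... | false | true  = -[1+ 0 ]
... | false | false = + 0

Matrix : ℕ → Set
Matrix k = Fin k → Fin k → ℤ

∑ : ∀ {k} → (Fin k → ℤ) → ℤ
∑ {ℕ.zero} f = + 0
∑ {suc k} f = f fzero + ∑ (λ i → f (fsuc i))

_⊗_ : ∀ {k} → Matrix k → Matrix k → Matrix k
(A ⊗ B) i j = ∑ (λ l → A i l * B l j)

-- L(π) for π ∈ S_{m+2}; indices are 0-based: row i ∈ Fin (m+1) stands for
-- the 1-based row i+1 (positions i+1, i+2 of π), column j for 1-based j+1.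
-- With a = π(i), b = π(i+1) as 0-based values, the 1-based condition
-- min ≤ j+1 < max becomes min a b ≤ j < max a b.
L : ∀ {m} → Permutation′ (suc (suc m)) → Matrix (suc m)
L π i j =
  let a = toℕ (π ⟨$⟩ʳ inject₁ i)
      b = toℕ (π ⟨$⟩ʳ fsuc i)
  in if ⌊ ℕ._⊓_ a b ℕ.≤? toℕ j ⌋ ∧ ⌊ toℕ j ℕ.<? ℕ._⊔_ a b ⌋
     then sgnDiff a b else + 0

-- Entries of L(π) are differences of indicators: L(π)ᵢⱼ = [j < π(i+1)] − [j < π(i)].
-- Hence column k of L(τ) is the discrete derivative of x ↦ [k < τ(x)], and its product
-- with row i of L(π) telescopes to [k < τ(π(i+1))] − [k < τ(π(i))] = L(τπ)ᵢₖ.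
module Submission where

open import Defs
open import Data.Nat using (ℕ; suc)
open import Data.Fin.Permutation using (Permutation′; _∘ₚ_)
open import Relation.Binary.PropositionalEquality using (_≡_)

open import Data.Bool using (if_then_else_; _∧_)
open import Data.Fin using (Fin; toℕ; inject₁) renaming (zero to fzero; suc to fsuc)
open import Data.Fin.Permutation using (_⟨$⟩ʳ_)
open import Data.Integer using (ℤ; +_; -1ℤ; _+_; _-_; _*_)
open import Data.Integer.Properties
  using (+-identityˡ; *-identityˡ; *-identityʳ; *-zeroʳ; +-inverseʳ; +-comm; +-minus-telescope)
open import Data.Integer.Tactic.RingSolver using (solve-∀)
open import Data.Nat as ℕ using (_≤_; _<_; _⊓_; _⊔_; zero; s≤s)
open import Data.Nat.Properties as ℕ
  using (<⇒≤; <⇒≱; <⇒≯; ≮⇒≥; ≤-refl; ≤-trans; <-cmp; ⊓-idem; ⊔-idem;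
         m≤n⇒m⊓n≡m; m≤n⇒m⊔n≡n; m≥n⇒m⊓n≡n; m≥n⇒m⊔n≡m)
open import Function using (_∘_)
open import Relation.Binary.Definitions using (tri<; tri≈; tri>)
open import Relation.Binary.PropositionalEquality using (refl; sym; trans; cong; cong₂; module ≡-Reasoning)
open import Relation.Nullary using (yes; no; contradiction)
open import Relation.Nullary.Decidable using (⌊_⌋)

[_<_] : ℕ → ℕ → ℤ
[ m < n ] = if ⌊ m ℕ.<? n ⌋ then + 1 else + 0

[suc<suc]≡[<] : ∀ m n → [ suc m < suc n ] ≡ [ m < n ]
[suc<suc]≡[<] m n with suc m ℕ.<? suc n | m ℕ.<? n
... | yes _ | yes _ = refl
... | yes 1+m<1+n | no m≮n = contradiction (ℕ.s≤s⁻¹ 1+m<1+n) m≮n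
... | no 1+m≮1+n | yes m<n = contradiction (s≤s m<n) 1+m≮1+n
... | no _ | no _ = refl

sgnDiff-< : ∀ {a b} → a < b → sgnDiff a b ≡ + 1
sgnDiff-< {a} {b} a<b with a ℕ.<? b
... | yes _ = refl
... | no a≮b = contradiction a<b a≮b

sgnDiff-> : ∀ {a b} → b < a → sgnDiff a b ≡ -1ℤ
sgnDiff-> {a} {b} b<a with a ℕ.<? b | b ℕ.<? a
... | yes a<b | _ = contradiction a<b (<⇒≯ b<a)
... | no _ | yes _ = refl
... | no _ | no b≮a = contradiction b<a b≮a

segment : ℕ → ℕ → ℕ → ℤ
segment a b j = if ⌊ a ⊓ b ℕ.≤? j ⌋ ∧ ⌊ j ℕ.<? a ⊔ b ⌋ then sgnDiff a b else + 0

interval-indicator : ∀ {a b} → a ≤ b → ∀ x j →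
  (if ⌊ a ℕ.≤? j ⌋ ∧ ⌊ j ℕ.<? b ⌋ then x else + 0) ≡ x * ([ j < b ] - [ j < a ])
interval-indicator {a} {b} a≤b x j with j ℕ.<? a | j ℕ.<? b | a ℕ.≤? j
... | yes j<a | _ | yes a≤j = contradiction a≤j (<⇒≱ j<a)
... | yes _ | yes _ | no _ = sym (*-zeroʳ x)
... | yes j<a | no j≮b | _ = contradiction (≤-trans j<a a≤b) j≮b
... | no j≮a | _ | no a≰j = contradiction (≮⇒≥ j≮a) a≰j
... | no _ | yes _ | yes _ = sym (*-identityʳ x)
... | no _ | no _ | yes _ = sym (*-zeroʳ x)

segment≡[<]-difference : ∀ a b j → segment a b j ≡ [ j < b ] - [ j < a ]
segment≡[<]-difference a b j with <-cmp a b
... | tri< a<b _ _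
  rewrite m≤n⇒m⊓n≡m (<⇒≤ a<b) | m≤n⇒m⊔n≡n (<⇒≤ a<b) | sgnDiff-< a<b
  = trans (interval-indicator (<⇒≤ a<b) (+ 1) j) (*-identityˡ ([ j < b ] - [ j < a ]))
... | tri≈ _ refl _
  rewrite ⊓-idem a | ⊔-idem a | +-inverseʳ [ j < a ]
  = trans (interval-indicator (≤-refl {a}) (sgnDiff a a) j)
          (trans (cong (sgnDiff a a *_) (+-inverseʳ [ j < a ])) (*-zeroʳ (sgnDiff a a)))
... | tri> _ _ b<a
  rewrite m≥n⇒m⊓n≡n (<⇒≤ b<a) | m≥n⇒m⊔n≡m (<⇒≤ b<a) | sgnDiff-> b<a
  = trans (interval-indicator (<⇒≤ b<a) -1ℤ j) (negate-difference [ j < a ] [ j < b ])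
  where
  negate-difference : ∀ p q → -1ℤ * (p - q) ≡ q - p
  negate-difference = solve-∀

L-entry : ∀ {m} (π : Permutation′ (suc (suc m))) i j →
  L π i j ≡ [ toℕ j < toℕ (π ⟨$⟩ʳ fsuc i) ] - [ toℕ j < toℕ (π ⟨$⟩ʳ inject₁ i) ]
L-entry π i j = segment≡[<]-difference (toℕ (π ⟨$⟩ʳ inject₁ i)) (toℕ (π ⟨$⟩ʳ fsuc i)) (toℕ j)

∑-cong : ∀ {k} {f g : Fin k → ℤ} → (∀ i → f i ≡ g i) → ∑ f ≡ ∑ g
∑-cong {zero} f≗g = refl
∑-cong {suc k} f≗g = cong₂ _+_ (f≗g fzero) (∑-cong (f≗g ∘ fsuc))

∑-zero : ∀ k → ∑ {k} (λ _ → + 0) ≡ + 0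
∑-zero zero = refl
∑-zero (suc k) = trans (+-identityˡ _) (∑-zero k)

∑-distrib-- : ∀ {k} (f g : Fin k → ℤ) → ∑ (λ i → f i - g i) ≡ ∑ f - ∑ g
∑-distrib-- {zero} f g = refl
∑-distrib-- {suc k} f g =
  trans (cong (_+_ (f fzero - g fzero)) (∑-distrib-- (f ∘ fsuc) (g ∘ fsuc)))
        (interchange (f fzero) (g fzero) (∑ (f ∘ fsuc)) (∑ (g ∘ fsuc)))
  where
  interchange : ∀ a b c d → (a - b) + (c - d) ≡ (a + c) - (b + d)
  interchange = solve-∀

Δ : ∀ {n} → (Fin (suc n) → ℤ) → Fin n → ℤ
Δ h j = h (fsuc j) - h (inject₁ j)

∑-telescope-below : ∀ {n} (h : Fin (suc n) → ℤ) (c : Fin (suc n)) →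
  ∑ (λ j → [ toℕ j < toℕ c ] * Δ h j) ≡ h c - h fzero
∑-telescope-below {n} h fzero = trans (∑-zero n) (sym (+-inverseʳ (h fzero)))
∑-telescope-below {suc n} h (fsuc c) = begin
    + 1 * Δ h fzero + ∑ (λ j → [ suc (toℕ j) < suc (toℕ c) ] * Δ (h ∘ fsuc) j)
  ≡⟨ cong₂ _+_ (*-identityˡ (Δ h fzero))
               (∑-cong (λ j → cong (_* Δ (h ∘ fsuc) j) ([suc<suc]≡[<] (toℕ j) (toℕ c)))) ⟩
    Δ h fzero + ∑ (λ j → [ toℕ j < toℕ c ] * Δ (h ∘ fsuc) j)
  ≡⟨ cong (_+_ (Δ h fzero)) (∑-telescope-below (h ∘ fsuc) c) ⟩
    (h one - h fzero) + (h (fsuc c) - h one)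
  ≡⟨ +-comm (h one - h fzero) (h (fsuc c) - h one) ⟩
    (h (fsuc c) - h one) + (h one - h fzero)
  ≡⟨ +-minus-telescope (h (fsuc c)) (h one) (h fzero) ⟩
    h (fsuc c) - h fzero
  ∎
  where
  open ≡-Reasoning
  one : Fin (suc (suc n))
  one = fsuc fzero

lemma2p2 : (m : ℕ) (π τ : Permutation′ (suc (suc m))) →
    ∀ i j → L (π ∘ₚ τ) i j ≡ (L π ⊗ L τ) i j
lemma2p2 m π τ i k = sym (begin
    ∑ (λ j → L π i j * L τ j k)
  ≡⟨ ∑-cong (λ j → trans (cong₂ _*_ (L-entry π i j) (L-entry τ j k))
                         (*-distribʳ-- [ toℕ j < toℕ B ] [ toℕ j < toℕ A ] (Δ h j))) ⟩
    ∑ (λ j → [ toℕ j < toℕ B ] * Δ h j - [ toℕ j < toℕ A ] * Δ h j)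
  ≡⟨ ∑-distrib-- (λ j → [ toℕ j < toℕ B ] * Δ h j) (λ j → [ toℕ j < toℕ A ] * Δ h j) ⟩
    ∑ (λ j → [ toℕ j < toℕ B ] * Δ h j) - ∑ (λ j → [ toℕ j < toℕ A ] * Δ h j)
  ≡⟨ cong₂ _-_ (∑-telescope-below h B) (∑-telescope-below h A) ⟩
    (h B - h fzero) - (h A - h fzero)
  ≡⟨ cancel (h B) (h A) (h fzero) ⟩
    h B - h A
  ≡⟨ sym (L-entry (π ∘ₚ τ) i k) ⟩
    L (π ∘ₚ τ) i k
  ∎)
  where
  open ≡-Reasoning
  A B : Fin (suc (suc m))
  A = π ⟨$⟩ʳ inject₁ i
  B = π ⟨$⟩ʳ fsuc i
  h : Fin (suc (suc m)) → ℤ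
  h x = [ toℕ k < toℕ (τ ⟨$⟩ʳ x) ]
  *-distribʳ-- : ∀ p q d → (p - q) * d ≡ p * d - q * d
  *-distribʳ-- = solve-∀
  cancel : ∀ x y z → (x - z) - (y - z) ≡ x - y
  cancel = solve-∀
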